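{- Let $\varphi,\psi$ be patterns and $x,y$ element variables such that $x$ is free for $y$ in $\varphi$ and $\psi$ is obtained from $\varphi$ by replacing one or more free occurrences of $x$ in $\varphi$ with $y$. Then $\vdash_{\mathcal{MG}^c}x=y\to(\varphi\leftrightarrow\psi)$.
   Context: Fix a countably infinite set $EVar$ of element variables and a set $\Sigma$ of constant symbols containing a distinguished "definedness symbol" $\lceil\,\rceil$. Patterns: $\varphi::= x\mid \sigma\mid \bot\mid \neg\varphi\mid \varphi\to\varphi\mid \varphi\wedge\varphi\mid\varphi\vee\varphi\mid \varphi\cdot\varphi\mid \forall x\varphi\mid\exists x\varphi$ ($\varphi\cdot\psi$ is application). Abbreviations: $\varphi\leftrightarrow\psi:=(\varphi\to\psi)\wedge(\psi\to\varphi)$, $\lceil\varphi\rceil:=\lceil\,\rceil\cdot\varphi$, $\lfloor\varphi\rfloor:=\neg\lceil\neg\varphi\rceil$, $\varphi=\psi:=\lfloor\varphi\leftrightarrow\psi\rfloor$. An occurrence of $x$ is bound if inside a subpattern $\forall x\eta$ or $\exists x\eta$, otherwise free. "$x$ is free for $y$ in $\varphi$" means no free occurrence of $x$ in $\varphi$ lies inside a subpattern of the form $\forall y\eta$ or $\exists y\eta$. $\vdash\psi$ means there is a finite sequence ending in $\psi$ of axiom instances or consequences of earlier members by rules. Proof system $\mathcal{MG}^c$. Axioms: $\varphi\vee\varphi\to\varphi$; $\varphi\to\varphi\wedge\varphi$; $\varphi\to\varphi\vee\psi$; $\varphi\wedge\psi\to\varphi$; $\varphi\vee\psi\to\psi\vee\varphi$;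 $\varphi\wedge\psi\to\psi\wedge\varphi$; $\bot\to\varphi$; $\varphi\vee\neg\varphi$; $\neg\varphi\to(\varphi\to\bot)$; $(\varphi\to\bot)\to\neg\varphi$; $\forall x(\varphi\to\psi)\to(\forall x\varphi\to\forall x\psi)$; $\varphi\to\forall x\varphi$ if $x$ does not occur in $\varphi$; $\exists x(x=y)$ for $y$ distinct from $x$; $\exists x\varphi\to\neg\forall x\neg\varphi$; $\neg\forall x\neg\varphi\to\exists x\varphi$; $(\varphi\vee\psi)\cdot\chi\to\varphi\cdot\chi\vee\psi\cdot\chi$; $\chi\cdot(\varphi\vee\psi)\to\chi\cdot\varphi\vee\chi\cdot\psi$; $(\exists x\varphi)\cdot\psi\to\exists x(\varphi\cdot\psi)$ and $\psi\cdot(\exists x\varphi)\to\exists x(\psi\cdot\varphi)$ if $x$ does not occur in $\psi$; $\lceil\varphi\rceil\cdot\psi\to\lceil\varphi\rceil$; $\psi\cdot\lceil\varphi\rceil\to\lceil\varphi\rceil$; $\lceil x\rceil$; $\varphi\to\lceil\varphi\rceil$; $\lceil\bot\rceil\to\bot$. Rules: from $\varphi$, $\varphi\to\psi$ infer $\psi$; from $\varphi\to\psi$, $\psi\to\chi$ infer $\varphi\to\chi$; from $\varphi\wedge\psi\to\chi$ infer $\varphi\to(\psi\to\chi)$; from $\varphi\to(\psi\to\chi)$ infer $\varphi\wedge\psi\to\chi$; from $\varphi\to\psi$ infer $\chi\vee\varphi\to\chi\vee\psi$; from $\varphi$ infer $\forall x\varphi$; from $\varphi\to\psi$ infer $\varphi\cdot\chi\to\psi\cdot\chi$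 and $\chi\cdot\varphi\to\chi\cdot\psi$. -}

module Defs where

open import Data.Nat using (ℕ)
open import Data.Bool using (Bool; true; false; _∨_)
open import Relation.Binary.PropositionalEquality using (_≡_; _≢_)
open import Relation.Nullary using (¬_)

EVar : Set
EVar = ℕ

data Pattern (S : Set) : Set where
  var  : EVar → Pattern S
  sym  : S → Pattern S
  ⊥ₚ   : Pattern S
  ¬ₚ_  : Pattern S → Pattern S
  _⇒_  : Pattern S → Pattern S → Pattern S
  _∧ₚ_ : Pattern S → Pattern S → Pattern S
  _∨ₚ_ : Pattern S → Pattern S → Pattern S
  _·_  : Pattern S → Pattern S → Pattern S
  ∀ₚ   : EVar → Pattern S → Pattern S
  ∃ₚ   : EVar → Pattern S → Pattern S

infixr 4 _⇒_
infixr 5 _∨ₚ_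
infixr 6 _∧ₚ_
infix 7 ¬ₚ_
infixl 8 _·_

module _ {S : Set} where

  data Occurs (x : EVar) : Pattern S → Set where
    o-var  : Occurs x (var x)
    o-¬    : ∀ {φ} → Occurs x φ → Occurs x (¬ₚ φ)
    o-⇒ˡ   : ∀ {φ ψ} → Occurs x φ → Occurs x (φ ⇒ ψ)
    o-⇒ʳ   : ∀ {φ ψ} → Occurs x ψ → Occurs x (φ ⇒ ψ)
    o-∧ˡ   : ∀ {φ ψ} → Occurs x φ → Occurs x (φ ∧ₚ ψ)
    o-∧ʳ   : ∀ {φ ψ} → Occurs x ψ → Occurs x (φ ∧ₚ ψ)
    o-∨ˡ   : ∀ {φ ψ} → Occurs x φ → Occurs x (φ ∨ₚ ψ)
    o-∨ʳ   : ∀ {φ ψ} → Occurs x ψ → Occurs x (φ ∨ₚ ψ)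
    o-·ˡ   : ∀ {φ ψ} → Occurs x φ → Occurs x (φ · ψ)
    o-·ʳ   : ∀ {φ ψ} → Occurs x ψ → Occurs x (φ · ψ)
    o-∀b   : ∀ {φ} → Occurs x (∀ₚ x φ)
    o-∀    : ∀ {z φ} → Occurs x φ → Occurs x (∀ₚ z φ)
    o-∃b   : ∀ {φ} → Occurs x (∃ₚ x φ)
    o-∃    : ∀ {z φ} → Occurs x φ → Occurs x (∃ₚ z φ)

  data FreeIn (x : EVar) : Pattern S → Set where
    f-var  : FreeIn x (var x)
    f-¬    : ∀ {φ} → FreeIn x φ → FreeIn x (¬ₚ φ)
    f-⇒ˡ   : ∀ {φ ψ} → FreeIn x φ → FreeIn x (φ ⇒ ψ)
    f-⇒ʳ   : ∀ {φ ψ} → FreeIn x ψ → FreeIn x (φ ⇒ ψ)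
    f-∧ˡ   : ∀ {φ ψ} → FreeIn x φ → FreeIn x (φ ∧ₚ ψ)
    f-∧ʳ   : ∀ {φ ψ} → FreeIn x ψ → FreeIn x (φ ∧ₚ ψ)
    f-∨ˡ   : ∀ {φ ψ} → FreeIn x φ → FreeIn x (φ ∨ₚ ψ)
    f-∨ʳ   : ∀ {φ ψ} → FreeIn x ψ → FreeIn x (φ ∨ₚ ψ)
    f-·ˡ   : ∀ {φ ψ} → FreeIn x φ → FreeIn x (φ · ψ)
    f-·ʳ   : ∀ {φ ψ} → FreeIn x ψ → FreeIn x (φ · ψ)
    f-∀    : ∀ {z φ} → z ≢ x → FreeIn x φ → FreeIn x (∀ₚ z φ)
    f-∃    : ∀ {z φ} → z ≢ x → FreeIn x φ → FreeIn x (∃ₚ z φ)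

  -- "x is free for y in φ": no free occurrence of x in φ lies inside a
  -- subpattern ∀y η or ∃y η.
  data FreeFor (x y : EVar) : Pattern S → Set where
    ff-var : ∀ {z} → FreeFor x y (var z)
    ff-sym : ∀ {s} → FreeFor x y (sym s)
    ff-⊥   : FreeFor x y ⊥ₚ
    ff-¬   : ∀ {φ} → FreeFor x y φ → FreeFor x y (¬ₚ φ)
    ff-⇒   : ∀ {φ ψ} → FreeFor x y φ → FreeFor x y ψ → FreeFor x y (φ ⇒ ψ)
    ff-∧   : ∀ {φ ψ} → FreeFor x y φ → FreeFor x y ψ → FreeFor x y (φ ∧ₚ ψ)
    ff-∨   : ∀ {φ ψ} → FreeFor x y φ → FreeFor x y ψ → FreeFor x y (φ ∨ₚ ψ)
    ff-·   : ∀ {φ ψ} → FreeFor x y φ → FreeFor x y ψ → FreeFor x y (φ · ψ)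
    -- binder x: x has no free occurrences inside
    ff-∀x  : ∀ {φ} → FreeFor x y (∀ₚ x φ)
    ff-∃x  : ∀ {φ} → FreeFor x y (∃ₚ x φ)
    ff-∀y  : ∀ {φ} → y ≢ x → ¬ FreeIn x φ → FreeFor x y (∀ₚ y φ)
    ff-∃y  : ∀ {φ} → y ≢ x → ¬ FreeIn x φ → FreeFor x y (∃ₚ y φ)
    ff-∀   : ∀ {z φ} → z ≢ x → z ≢ y → FreeFor x y φ → FreeFor x y (∀ₚ z φ)
    ff-∃   : ∀ {z φ} → z ≢ x → z ≢ y → FreeFor x y φ → FreeFor x y (∃ₚ z φ)

  -- Repl x y b φ ψ : ψ is obtained from φ by replacing some free occurrences
  -- of x with y; b = true iff at least one occurrence was replaced.
  data Repl (x y : EVar) : Bool → Pattern S → Pattern S → Set where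
    r-keep : ∀ {z} → Repl x y false (var z) (var z)
    r-repl : Repl x y true (var x) (var y)
    r-sym  : ∀ {s} → Repl x y false (sym s) (sym s)
    r-⊥    : Repl x y false ⊥ₚ ⊥ₚ
    r-¬    : ∀ {b φ ψ} → Repl x y b φ ψ → Repl x y b (¬ₚ φ) (¬ₚ ψ)
    r-⇒    : ∀ {b c φ φ' ψ ψ'} → Repl x y b φ φ' → Repl x y c ψ ψ'
           → Repl x y (b ∨ c) (φ ⇒ ψ) (φ' ⇒ ψ')
    r-∧    : ∀ {b c φ φ' ψ ψ'} → Repl x y b φ φ' → Repl x y c ψ ψ'
           → Repl x y (b ∨ c) (φ ∧ₚ ψ) (φ' ∧ₚ ψ')
    r-∨    : ∀ {b c φ φ' ψ ψ'} → Repl x y b φ φ' → Repl x y c ψ ψ'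
           → Repl x y (b ∨ c) (φ ∨ₚ ψ) (φ' ∨ₚ ψ')
    r-·    : ∀ {b c φ φ' ψ ψ'} → Repl x y b φ φ' → Repl x y c ψ ψ'
           → Repl x y (b ∨ c) (φ · ψ) (φ' · ψ')
    -- occurrences of x under a binder for x are bound: nothing replaced
    r-∀x   : ∀ {φ} → Repl x y false (∀ₚ x φ) (∀ₚ x φ)
    r-∃x   : ∀ {φ} → Repl x y false (∃ₚ x φ) (∃ₚ x φ)
    r-∀    : ∀ {b z φ ψ} → z ≢ x → Repl x y b φ ψ → Repl x y b (∀ₚ z φ) (∀ₚ z ψ)
    r-∃    : ∀ {b z φ ψ} → z ≢ x → Repl x y b φ ψ → Repl x y b (∃ₚ z φ) (∃ₚ z ψ)

module Abbrev {S : Set} (d : S) where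
  infix 3 _⇔_
  _⇔_ : Pattern S → Pattern S → Pattern S
  φ ⇔ ψ = (φ ⇒ ψ) ∧ₚ (ψ ⇒ φ)

  ⌈_⌉ : Pattern S → Pattern S
  ⌈ φ ⌉ = sym d · φ

  ⌊_⌋ : Pattern S → Pattern S
  ⌊ φ ⌋ = ¬ₚ ⌈ ¬ₚ φ ⌉

  infix 3 _≐_
  _≐_ : Pattern S → Pattern S → Pattern S
  φ ≐ ψ = ⌊ φ ⇔ ψ ⌋

module _ {S : Set} (d : S) where
  open Abbrev d

  data ⊢ : Pattern S → Set where
    ax-∨idem   : ∀ φ → ⊢ (φ ∨ₚ φ ⇒ φ)
    ax-∧dup    : ∀ φ → ⊢ (φ ⇒ φ ∧ₚ φ)
    ax-∨intro  : ∀ φ ψ → ⊢ (φ ⇒ φ ∨ₚ ψ)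
    ax-∧elim   : ∀ φ ψ → ⊢ (φ ∧ₚ ψ ⇒ φ)
    ax-∨comm   : ∀ φ ψ → ⊢ (φ ∨ₚ ψ ⇒ ψ ∨ₚ φ)
    ax-∧comm   : ∀ φ ψ → ⊢ (φ ∧ₚ ψ ⇒ ψ ∧ₚ φ)
    ax-⊥       : ∀ φ → ⊢ (⊥ₚ ⇒ φ)
    ax-lem     : ∀ φ → ⊢ (φ ∨ₚ ¬ₚ φ)
    ax-¬elim   : ∀ φ → ⊢ (¬ₚ φ ⇒ (φ ⇒ ⊥ₚ))
    ax-¬intro  : ∀ φ → ⊢ ((φ ⇒ ⊥ₚ) ⇒ ¬ₚ φ)
    ax-∀K      : ∀ x φ ψ → ⊢ (∀ₚ x (φ ⇒ ψ) ⇒ (∀ₚ x φ ⇒ ∀ₚ x ψ))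
    ax-∀vac    : ∀ x φ → ¬ Occurs x φ → ⊢ (φ ⇒ ∀ₚ x φ)
    ax-∃eq     : ∀ x y → y ≢ x → ⊢ (∃ₚ x (var x ≐ var y))
    ax-∃→      : ∀ x φ → ⊢ (∃ₚ x φ ⇒ ¬ₚ ∀ₚ x (¬ₚ φ))
    ax-∃←      : ∀ x φ → ⊢ (¬ₚ ∀ₚ x (¬ₚ φ) ⇒ ∃ₚ x φ)
    ax-prop∨ˡ  : ∀ φ ψ χ → ⊢ ((φ ∨ₚ ψ) · χ ⇒ φ · χ ∨ₚ ψ · χ)
    ax-prop∨ʳ  : ∀ φ ψ χ → ⊢ (χ · (φ ∨ₚ ψ) ⇒ χ · φ ∨ₚ χ · ψ)
    ax-prop∃ˡ  : ∀ x φ ψ → ¬ Occurs x ψ → ⊢ ((∃ₚ x φ) · ψ ⇒ ∃ₚ x (φ · ψ))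
    ax-prop∃ʳ  : ∀ x φ ψ → ¬ Occurs x ψ → ⊢ (ψ · (∃ₚ x φ) ⇒ ∃ₚ x (ψ · φ))
    ax-⌈⌉ˡ     : ∀ φ ψ → ⊢ (⌈ φ ⌉ · ψ ⇒ ⌈ φ ⌉)
    ax-⌈⌉ʳ     : ∀ φ ψ → ⊢ (ψ · ⌈ φ ⌉ ⇒ ⌈ φ ⌉)
    ax-defvar  : ∀ x → ⊢ ⌈ var x ⌉
    ax-⌈⌉intro : ∀ φ → ⊢ (φ ⇒ ⌈ φ ⌉)
    ax-⌈⊥⌉     : ⊢ (⌈ ⊥ₚ ⌉ ⇒ ⊥ₚ)
    r-mp       : ∀ {φ ψ} → ⊢ φ → ⊢ (φ ⇒ ψ) → ⊢ ψ
    r-syll     : ∀ {φ ψ χ} → ⊢ (φ ⇒ ψ) → ⊢ (ψ ⇒ χ) → ⊢ (φ ⇒ χ)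
    r-exp      : ∀ {φ ψ χ} → ⊢ (φ ∧ₚ ψ ⇒ χ) → ⊢ (φ ⇒ (ψ ⇒ χ))
    r-imp      : ∀ {φ ψ χ} → ⊢ (φ ⇒ (ψ ⇒ χ)) → ⊢ (φ ∧ₚ ψ ⇒ χ)
    r-∨mono    : ∀ {φ ψ} χ → ⊢ (φ ⇒ ψ) → ⊢ (χ ∨ₚ φ ⇒ χ ∨ₚ ψ)
    r-gen      : ∀ {φ} x → ⊢ φ → ⊢ (∀ₚ x φ)
    r-framingˡ : ∀ {φ ψ} χ → ⊢ (φ ⇒ ψ) → ⊢ (φ · χ ⇒ ψ · χ)
    r-framingʳ : ∀ {φ ψ} χ → ⊢ (φ ⇒ ψ) → ⊢ (χ · φ ⇒ χ · ψ)

{-# OPTIONS --safe #-}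
-- A replaced occurrence is an instance of
-- ⌊ x ⇔ y ⌋ → (x ⇔ y). The propositional connectives are congruences under
-- any hypothesis. Application is one under a hypothesis of the form ⌊ e ⌋,
-- such as x = y, because ⌊ e ⌋ implies ⌊ ⌊ e ⌋ ⌋ and ⌊ χ ⇒ χ' ⌋ gives
-- χ · ψ ⇒ χ' · ψ: the part of χ · ψ outside χ' · ψ lies in ⌈ ¬ (χ ⇒ χ') ⌉. A binder z ∉ {x, y} can be
-- generalised over since z does not occur in x = y, and under a binder y
-- nothing is replaced, since x is free for y.
module Submission where

open import Defs
open import Data.Bool using (Bool; true)
open import Data.Empty using (⊥-elim)
open import Function using (_∘_)
open import Relation.Nullary using (¬_)
open import Relation.Binary.PropositionalEquality using (_≡_; _≢_; refl; cong; cong₂)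

module Entailment {S : Set} (d : S) where
  open Abbrev d

  private
    variable
      Γ e a a' b b' c : Pattern S
      C : Pattern S → Pattern S

  infix 2 _⊩_
  _⊩_ : Pattern S → Pattern S → Set
  Γ ⊩ a = ⊢ d (Γ ⇒ a)

  ⇒-refl : a ⊩ a
  ⇒-refl {a} = r-syll (ax-∧dup a) (ax-∧elim a a)

  ⇒-const : ⊢ d a → Γ ⊩ a
  ⇒-const {a} {Γ} p = r-mp p (r-exp (ax-∧elim a Γ))

  ⇒-swap : a ⊩ b ⇒ c → b ⊩ a ⇒ c
  ⇒-swap {a} {b} p = r-exp (r-syll (ax-∧comm b a) (r-imp p))

  weaken : Γ ⊩ a → Γ ∧ₚ b ⊩ a
  weaken {Γ} {b = b} p = r-syll (ax-∧elim Γ b) p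

  ∧-elimˡ : Γ ⊩ a ∧ₚ b → Γ ⊩ a
  ∧-elimˡ {a = a} {b} p = r-syll p (ax-∧elim a b)

  ∧-elimʳ : Γ ⊩ a ∧ₚ b → Γ ⊩ b
  ∧-elimʳ {a = a} {b} p = r-syll p (r-syll (ax-∧comm a b) (ax-∧elim b a))

  assume : Γ ∧ₚ a ⊩ a
  assume = ∧-elimʳ ⇒-refl

  ∧-monoʳ : b ⊩ b' → a ∧ₚ b ⊩ a ∧ₚ b'
  ∧-monoʳ q = r-imp (⇒-swap (r-syll q (⇒-swap (r-exp ⇒-refl))))

  ∧-monoˡ : a ⊩ a' → a ∧ₚ b ⊩ a' ∧ₚ b
  ∧-monoˡ {a} {a'} {b} q = r-syll (ax-∧comm a b) (r-syll (∧-monoʳ q) (ax-∧comm b a'))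

  ∧-intro : Γ ⊩ a → Γ ⊩ b → Γ ⊩ a ∧ₚ b
  ∧-intro {Γ} p q = r-syll (ax-∧dup Γ) (r-syll (∧-monoˡ p) (∧-monoʳ q))

  ⇒-elim : Γ ⊩ a ⇒ b → Γ ⊩ a → Γ ⊩ b
  ⇒-elim p q = r-syll (∧-intro ⇒-refl q) (r-imp p)

  ∨-introˡ : Γ ⊩ a → Γ ⊩ a ∨ₚ b
  ∨-introˡ {a = a} {b} p = r-syll p (ax-∨intro a b)

  ∨-introʳ : Γ ⊩ b → Γ ⊩ a ∨ₚ b
  ∨-introʳ {b = b} {a} p = r-syll p (r-syll (ax-∨intro b a) (ax-∨comm b a))

  ∨-monoˡ : a ⊩ a' → a ∨ₚ b ⊩ a' ∨ₚ b
  ∨-monoˡ {a} {a'} {b} q = r-syll (ax-∨comm a b) (r-syll (r-∨mono b q) (ax-∨comm b a'))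

  [_,_] : a ⊩ c → b ⊩ c → a ∨ₚ b ⊩ c
  [_,_] {c = c} p q = r-syll (∨-monoˡ p) (r-syll (r-∨mono c q) (ax-∨idem c))

  ∧-distribˡ-∨ : Γ ∧ₚ (a ∨ₚ b) ⊩ (Γ ∧ₚ a) ∨ₚ (Γ ∧ₚ b)
  ∧-distribˡ-∨ =
    r-imp (⇒-swap [ ⇒-swap (r-exp (∨-introˡ ⇒-refl)) , ⇒-swap (r-exp (∨-introʳ ⇒-refl)) ])

  ∨-elim : Γ ⊩ a ∨ₚ b → Γ ∧ₚ a ⊩ c → Γ ∧ₚ b ⊩ c → Γ ⊩ c
  ∨-elim p q r = r-syll (∧-intro ⇒-refl p) (r-syll ∧-distribˡ-∨ [ q , r ])

  ⊥ₚ-elim : Γ ⊩ ⊥ₚ → Γ ⊩ c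
  ⊥ₚ-elim {c = c} p = r-syll p (ax-⊥ c)

  ¬-intro : Γ ∧ₚ a ⊩ ⊥ₚ → Γ ⊩ ¬ₚ a
  ¬-intro {a = a} p = r-syll (r-exp p) (ax-¬intro a)

  ¬-elim : Γ ⊩ ¬ₚ a → Γ ⊩ a → Γ ⊩ ⊥ₚ
  ¬-elim {a = a} p q = ⇒-elim (r-syll p (ax-¬elim a)) q

  ¬¬-elim : Γ ⊩ ¬ₚ ¬ₚ a → Γ ⊩ a
  ¬¬-elim {a = a} p = ∨-elim (⇒-const (ax-lem a)) assume (⊥ₚ-elim (¬-elim (weaken p) assume))

  contrapose : Γ ⊩ a ⇒ b → Γ ⊩ ¬ₚ b ⇒ ¬ₚ a
  contrapose p = r-exp (¬-intro (¬-elim (weaken assume) (⇒-elim (weaken (weaken p)) assume)))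

  contrapose₀ : a ⊩ b → ¬ₚ b ⊩ ¬ₚ a
  contrapose₀ p = ⇒-elim (contrapose (⇒-const p)) ⇒-refl

  ⇔-refl : Γ ⊩ a ⇔ a
  ⇔-refl = ∧-intro (⇒-const ⇒-refl) (⇒-const ⇒-refl)

  ⇔-sym : Γ ⊩ a ⇔ b → Γ ⊩ b ⇔ a
  ⇔-sym p = ∧-intro (∧-elimʳ p) (∧-elimˡ p)

  ⇔-mp : Γ ⊩ a ⇔ a' → Γ ⊩ a → Γ ⊩ a'
  ⇔-mp p = ⇒-elim (∧-elimˡ p)

  ⇔-from-mono₁ : (f : Pattern S → Pattern S)
               → (∀ {a a'} → Γ ⊩ a ⇔ a' → Γ ⊩ f a ⇒ f a')
               → Γ ⊩ a ⇔ a' → Γ ⊩ f a ⇔ f a'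
  ⇔-from-mono₁ f mono p = ∧-intro (mono p) (mono (⇔-sym p))

  ⇔-from-mono₂ : (f : Pattern S → Pattern S → Pattern S)
               → (∀ {a a' b b'} → Γ ⊩ a ⇔ a' → Γ ⊩ b ⇔ b' → Γ ⊩ f a b ⇒ f a' b')
               → Γ ⊩ a ⇔ a' → Γ ⊩ b ⇔ b' → Γ ⊩ f a b ⇔ f a' b'
  ⇔-from-mono₂ f mono p q = ∧-intro (mono p q) (mono (⇔-sym p) (⇔-sym q))

  ¬-cong : Γ ⊩ a ⇔ a' → Γ ⊩ ¬ₚ a ⇔ ¬ₚ a'
  ¬-cong = ⇔-from-mono₁ ¬ₚ_ (λ p → contrapose (∧-elimʳ p))

  ⇒-cong : Γ ⊩ a ⇔ a' → Γ ⊩ b ⇔ b' → Γ ⊩ (a ⇒ b) ⇔ (a' ⇒ b')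
  ⇒-cong = ⇔-from-mono₂ _⇒_ λ p q → r-exp (r-exp
    (⇔-mp (weaken (weaken q)) (⇒-elim (weaken assume) (⇔-mp (weaken (weaken (⇔-sym p))) assume))))

  ∧-cong : Γ ⊩ a ⇔ a' → Γ ⊩ b ⇔ b' → Γ ⊩ (a ∧ₚ b) ⇔ (a' ∧ₚ b')
  ∧-cong = ⇔-from-mono₂ _∧ₚ_ λ p q → r-exp
    (∧-intro (⇔-mp (weaken p) (∧-elimˡ assume)) (⇔-mp (weaken q) (∧-elimʳ assume)))

  ∨-cong : Γ ⊩ a ⇔ a' → Γ ⊩ b ⇔ b' → Γ ⊩ (a ∨ₚ b) ⇔ (a' ∨ₚ b')
  ∨-cong = ⇔-from-mono₂ _∨ₚ_ λ p q → r-exp (∨-elim assume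
    (∨-introˡ (⇔-mp (weaken (weaken p)) assume))
    (∨-introʳ (⇔-mp (weaken (weaken q)) assume)))

  ⌊⌋-mono : a ⊩ b → ⌊ a ⌋ ⊩ ⌊ b ⌋
  ⌊⌋-mono q = contrapose₀ (r-framingʳ (sym d) (contrapose₀ q))

  ⌊⌋-elim : ⌊ a ⌋ ⊩ a
  ⌊⌋-elim {a} = ¬¬-elim (contrapose₀ (ax-⌈⌉intro (¬ₚ a)))

  ⌊⌋-dup : ⌊ a ⌋ ⊩ ⌊ ⌊ a ⌋ ⌋
  ⌊⌋-dup {a} =
    contrapose₀ (r-syll (r-framingʳ (sym d) (¬¬-elim ⇒-refl)) (ax-⌈⌉ʳ (¬ₚ a) (sym d)))

  ⌊⌋-necessitation : ⌊ e ⌋ ⊩ a → ⌊ e ⌋ ⊩ ⌊ a ⌋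
  ⌊⌋-necessitation p = r-syll ⌊⌋-dup (⌊⌋-mono p)

  record Frame (C : Pattern S → Pattern S) : Set where
    field
      mono      : a ⊩ b → C a ⊩ C b
      distrib-∨ : C (a ∨ₚ b) ⊩ C a ∨ₚ C b
      absorb-⌈⌉ : C ⌈ a ⌉ ⊩ ⌈ a ⌉

  ·-frameˡ : Frame (_· b)
  ·-frameˡ {b} = record
    { mono = r-framingˡ b ; distrib-∨ = ax-prop∨ˡ _ _ b ; absorb-⌈⌉ = ax-⌈⌉ˡ _ b }

  ·-frameʳ : Frame (a ·_)
  ·-frameʳ {a} = record
    { mono = r-framingʳ a ; distrib-∨ = ax-prop∨ʳ _ _ a ; absorb-⌈⌉ = ax-⌈⌉ʳ _ a }

  ⌊⌋-transport : Frame C → ⌊ a ⇒ a' ⌋ ∧ₚ C a ⊩ C a'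
  ⌊⌋-transport {C} {a} {a'} F =
    ∨-elim (r-syll assume split) assume (⊥ₚ-elim (¬-elim (weaken (∧-elimˡ ⇒-refl)) assume))
    where
    open Frame F
    excluded-middle : a ⊩ a' ∨ₚ (a ∧ₚ ¬ₚ a')
    excluded-middle =
      ∨-elim (⇒-const (ax-lem a')) (∨-introˡ assume) (∨-introʳ (∧-intro (∧-elimˡ ⇒-refl) assume))
    counterexample : a ∧ₚ ¬ₚ a' ⊩ ⌈ ¬ₚ (a ⇒ a') ⌉
    counterexample =
      r-syll (¬-intro (¬-elim (weaken (∧-elimʳ ⇒-refl)) (⇒-elim assume (weaken (∧-elimˡ ⇒-refl)))))
             (ax-⌈⌉intro (¬ₚ (a ⇒ a')))
    split : C a ⊩ C a' ∨ₚ ⌈ ¬ₚ (a ⇒ a') ⌉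
    split = r-syll (mono excluded-middle)
      (r-syll distrib-∨ (r-∨mono (C a') (r-syll (mono counterexample) absorb-⌈⌉)))

  ·-mono : Γ ⊩ ⌊ a ⇒ a' ⌋ → Γ ⊩ ⌊ b ⇒ b' ⌋ → Γ ⊩ a · b ⇒ a' · b'
  ·-mono p q = r-exp (r-syll
    (∧-intro (weaken q) (r-syll (∧-intro (weaken p) assume) (⌊⌋-transport ·-frameˡ)))
    (⌊⌋-transport ·-frameʳ))

  ·-cong : ⌊ e ⌋ ⊩ a ⇔ a' → ⌊ e ⌋ ⊩ b ⇔ b' → ⌊ e ⌋ ⊩ a · b ⇔ a' · b'
  ·-cong = ⇔-from-mono₂ _·_ λ p q →
    ·-mono (⌊⌋-necessitation (∧-elimˡ p)) (⌊⌋-necessitation (∧-elimˡ q))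

  module _ {z : EVar} (z∉Γ : ¬ Occurs z Γ) where

    ∀-mono : Γ ⊩ a ⇒ a' → Γ ⊩ ∀ₚ z a ⇒ ∀ₚ z a'
    ∀-mono {a} {a'} p =
      r-syll (r-syll (ax-∀vac z Γ z∉Γ) (r-mp (r-gen z p) (ax-∀K z Γ (a ⇒ a')))) (ax-∀K z a a')

    ∃-mono : Γ ⊩ a ⇒ a' → Γ ⊩ ∃ₚ z a ⇒ ∃ₚ z a'
    ∃-mono {a} {a'} p =
      r-exp (r-syll (r-syll (∧-monoʳ (ax-∃→ z a)) (r-imp (contrapose (∀-mono (contrapose p)))))
                    (ax-∃← z a'))

    ∀-cong : Γ ⊩ a ⇔ a' → Γ ⊩ ∀ₚ z a ⇔ ∀ₚ z a'
    ∀-cong = ⇔-from-mono₁ (∀ₚ z) λ p → ∀-mono (∧-elimˡ p)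

    ∃-cong : Γ ⊩ a ⇔ a' → Γ ⊩ ∃ₚ z a ⇔ ∃ₚ z a'
    ∃-cong = ⇔-from-mono₁ (∃ₚ z) λ p → ∃-mono (∧-elimˡ p)

module _ {S : Set} {x y : EVar} where

  private
    variable
      b : Bool
      φ ψ : Pattern S

  Repl-unfree : ¬ FreeIn x φ → Repl x y b φ ψ → φ ≡ ψ
  Repl-unfree _ r-keep = refl
  Repl-unfree x∉φ r-repl = ⊥-elim (x∉φ f-var)
  Repl-unfree _ r-sym = refl
  Repl-unfree _ r-⊥ = refl
  Repl-unfree x∉φ (r-¬ r) = cong ¬ₚ_ (Repl-unfree (x∉φ ∘ f-¬) r)
  Repl-unfree x∉φ (r-⇒ r s) =
    cong₂ _⇒_ (Repl-unfree (x∉φ ∘ f-⇒ˡ) r) (Repl-unfree (x∉φ ∘ f-⇒ʳ) s)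
  Repl-unfree x∉φ (r-∧ r s) =
    cong₂ _∧ₚ_ (Repl-unfree (x∉φ ∘ f-∧ˡ) r) (Repl-unfree (x∉φ ∘ f-∧ʳ) s)
  Repl-unfree x∉φ (r-∨ r s) =
    cong₂ _∨ₚ_ (Repl-unfree (x∉φ ∘ f-∨ˡ) r) (Repl-unfree (x∉φ ∘ f-∨ʳ) s)
  Repl-unfree x∉φ (r-· r s) =
    cong₂ _·_ (Repl-unfree (x∉φ ∘ f-·ˡ) r) (Repl-unfree (x∉φ ∘ f-·ʳ) s)
  Repl-unfree _ r-∀x = refl
  Repl-unfree _ r-∃x = refl
  Repl-unfree x∉φ (r-∀ {z = z} z≢x r) = cong (∀ₚ z) (Repl-unfree (x∉φ ∘ f-∀ z≢x) r)
  Repl-unfree x∉φ (r-∃ {z = z} z≢x r) = cong (∃ₚ z) (Repl-unfree (x∉φ ∘ f-∃ z≢x) r)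

  module _ (d : S) where
    open Abbrev d
    open Entailment d

    ≐-not-occurs : ∀ {z} → z ≢ x → z ≢ y → ¬ Occurs z (var x ≐ var y)
    ≐-not-occurs z≢x z≢y (o-¬ (o-·ʳ (o-¬ (o-∧ˡ (o-⇒ˡ o-var))))) = z≢x refl
    ≐-not-occurs z≢x z≢y (o-¬ (o-·ʳ (o-¬ (o-∧ˡ (o-⇒ʳ o-var))))) = z≢y refl
    ≐-not-occurs z≢x z≢y (o-¬ (o-·ʳ (o-¬ (o-∧ʳ (o-⇒ˡ o-var))))) = z≢y refl
    ≐-not-occurs z≢x z≢y (o-¬ (o-·ʳ (o-¬ (o-∧ʳ (o-⇒ʳ o-var))))) = z≢x refl

    ≐-subst : FreeFor x y φ → Repl x y b φ ψ → var x ≐ var y ⊩ φ ⇔ ψ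
    ≐-subst _ r-keep = ⇔-refl
    ≐-subst _ r-repl = ⌊⌋-elim
    ≐-subst _ r-sym = ⇔-refl
    ≐-subst _ r-⊥ = ⇔-refl
    ≐-subst (ff-¬ f) (r-¬ r) = ¬-cong (≐-subst f r)
    ≐-subst (ff-⇒ f g) (r-⇒ r s) = ⇒-cong (≐-subst f r) (≐-subst g s)
    ≐-subst (ff-∧ f g) (r-∧ r s) = ∧-cong (≐-subst f r) (≐-subst g s)
    ≐-subst (ff-∨ f g) (r-∨ r s) = ∨-cong (≐-subst f r) (≐-subst g s)
    ≐-subst (ff-· f g) (r-· r s) = ·-cong (≐-subst f r) (≐-subst g s)
    ≐-subst _ r-∀x = ⇔-refl
    ≐-subst _ r-∃x = ⇔-refl
    ≐-subst ff-∀x (r-∀ x≢x _) = ⊥-elim (x≢x refl)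
    ≐-subst ff-∃x (r-∃ x≢x _) = ⊥-elim (x≢x refl)
    ≐-subst (ff-∀y _ x∉φ) (r-∀ _ r) rewrite Repl-unfree x∉φ r = ⇔-refl
    ≐-subst (ff-∃y _ x∉φ) (r-∃ _ r) rewrite Repl-unfree x∉φ r = ⇔-refl
    ≐-subst (ff-∀ z≢x z≢y f) (r-∀ _ r) = ∀-cong (≐-not-occurs z≢x z≢y) (≐-subst f r)
    ≐-subst (ff-∃ z≢x z≢y f) (r-∃ _ r) = ∃-cong (≐-not-occurs z≢x z≢y) (≐-subst f r)

mainTheorem9 : {S : Set} (d : S) (x y : EVar) (φ ψ : Pattern S)
    → FreeFor x y φ → Repl x y true φ ψ
    → ⊢ d (Abbrev._≐_ d (var x) (var y) ⇒ Abbrev._⇔_ d φ ψ)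
mainTheorem9 d x y φ ψ = ≐-subst d
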